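{- Let $n \geq 1$ and $d \geq 0$. Suppose that there exists an $n$-input sorting network of depth $d$. Then $|R_{n,d}| = 1$.
   Context: Channels are $1, \dots, n$. A comparator is an ordered pair $\langle i, j \rangle$ with $1 \leq i < j \leq n$; a level is a set of comparators in which every channel occurs at most once; an $n$-input comparator network of depth $d$ is a sequence of $d$ levels. Applying a level $L$ to $z \in \{0,1\}^n$ gives $z'$ with $z'_i = \min(z_i,z_j)$, $z'_j = \max(z_i,z_j)$ for each $\langle i,j\rangle \in L$ and other coordinates unchanged; the output $V_C(x)$ of $C = \langle L_1,\dots,L_d\rangle$ on $x \in \{0,1\}^n$ is obtained by applying $L_1,\dots,L_d$ in turn, and the output set is $S_C = \{V_C(x) : x \in \{0,1\}^n\}$. $C$ is a sorting network if every $V_C(x)$ is sorted (non-decreasing). A permutation $\pi$ of $\{1,\dots,n\}$ acts on vectors by permuting coordinates, and the reflection maps $x = \langle x_1,\dots,x_n\rangle$ to $\overline{x^R} = \langle 1-x_n, 1-x_{n-1}, \dots, 1-x_1 \rangle$; let $\Sigma$ be the group of maps on $\{0,1\}^n$ generated by coordinate permutations and the reflection, acting on sets of vectors elementwise. Let $G_{n,d}$ be the set of output sets $S_C$ of all $n$-input comparator networks $C$ of depth $d$. Call $S \in G_{n,d}$ minimal if there is no $S' \in G_{n,d}$ and $\sigma \in \Sigma$ with $\sigma(S') \subsetneq S$. Call $S, S' \in G_{n,d}$ equivalent if $\sigma(S') = S$ for some $\sigma \in \Sigma$. $R_{n,d}$ (the set of minimal representative output sets up to permutation and reflection) consists of exactly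 one element from each equivalence class of minimal elements of $G_{n,d}$. -}

module Defs where

open import Level using (0ℓ)
open import Data.Nat using (ℕ)
open import Data.Bool using (Bool; true; false; _∧_; _∨_; not)
import Data.Bool as B
open import Data.Fin using (Fin) renaming (_<_ to _<ᶠ_; _≤_ to _≤ᶠ_)
open import Data.Fin.Permutation using (Permutation′; _⟨$⟩ʳ_)
open import Data.Vec using (Vec; lookup; tabulate; _[_]≔_; reverse; map)
import Data.Vec as V
open import Data.List using (List; []; _∷_; concatMap; foldl; length)
import Data.List as L
open import Data.List.Relation.Unary.Unique.Propositional using (Unique)
open import Data.Product using (Σ; ∃; ∃-syntax; _×_; _,_; proj₁)
open import Relation.Nullary using (¬_)
open import Relation.Unary using (Pred; _⊆_)
open import Relation.Binary.PropositionalEquality using (_≡_)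

-- Binary vectors of length n; channel i (1..n in the paper) is Fin n.
BVec : ℕ → Set
BVec n = Vec Bool n

record Comparator (n : ℕ) : Set where
  constructor ⟨_,_⟩[_]
  field
    i : Fin n
    j : Fin n
    i<j : i <ᶠ j
open Comparator public

channels : ∀ {n} → List (Comparator n) → List (Fin n)
channels = concatMap (λ c → i c ∷ j c ∷ [])

Level : ℕ → Set
Level n = Σ (List (Comparator n)) (λ cs → Unique (channels cs))

applyComp : ∀ {n} → Comparator n → BVec n → BVec n
applyComp c z =
  (z [ i c ]≔ (lookup z (i c) ∧ lookup z (j c))) [ j c ]≔ (lookup z (i c) ∨ lookup z (j c))

-- Applying a level (comparators are channel-disjoint, so sequential
-- application equals simultaneous application).
applyLevel : ∀ {n} → Level n → BVec n → BVec n
applyLevel (cs , _) z = foldl (λ w c → applyComp c w) z cs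

Network : ℕ → ℕ → Set
Network n d = Vec (Level n) d

output : ∀ {n d} → Network n d → BVec n → BVec n
output C x = V.foldl (λ _ → BVec _) (λ z L → applyLevel L z) x C

VSet : ℕ → Set₁
VSet n = Pred (BVec n) 0ℓ

outSet : ∀ {n d} → Network n d → VSet n
outSet C z = ∃[ x ] output C x ≡ z

Sorted : ∀ {n} → BVec n → Set
Sorted {n} v = ∀ (a b : Fin n) → a ≤ᶠ b → lookup v a B.≤ lookup v b

IsSortingNetwork : ∀ {n d} → Network n d → Set
IsSortingNetwork C = ∀ x → Sorted (output C x)

_≐_ : ∀ {n} → VSet n → VSet n → Set
S ≐ T = S ⊆ T × T ⊆ S

_⊊_ : ∀ {n} → VSet n → VSet n → Set
S ⊊ T = S ⊆ T × ¬ (T ⊆ S)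

data Gen (n : ℕ) : Set where
  perm    : Permutation′ n → Gen n
  reflect : Gen n

applyGen : ∀ {n} → Gen n → BVec n → BVec n
applyGen (perm π) x = tabulate (λ k → lookup x (π ⟨$⟩ʳ k))
applyGen reflect  x = map not (reverse x)

-- Elements of the group Σ generated by the generators: finite words
-- (each generator's inverse is again a generator, so words = group elements).
SymW : ℕ → Set
SymW n = List (Gen n)

applySym : ∀ {n} → SymW n → BVec n → BVec n
applySym []       x = x
applySym (g ∷ gs) x = applyGen g (applySym gs x)

actSet : ∀ {n} → SymW n → VSet n → VSet n
actSet σ S y = ∃[ x ] (S x × applySym σ x ≡ y)

InG : ∀ n d → VSet n → Set
InG n d S = ∃[ C ] (S ≐ outSet {n} {d} C)

Minimal : ∀ n d → VSet n → Set₁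
Minimal n d S = InG n d S ×
  ¬ (∃[ S' ] (InG n d S' × ∃[ σ ] (actSet σ S' ⊊ S)))

Equivalent : ∀ {n} → VSet n → VSet n → Set
Equivalent S S' = ∃[ σ ] (actSet σ S' ≐ S)

IsRepresentatives : ∀ n d → List (VSet n) → Set₁
IsRepresentatives n d R =
  (∀ (k : Fin (length R)) → Minimal n d (L.lookup R k)) ×
  (∀ S → Minimal n d S →
     ∃[ k ] (Equivalent (L.lookup R k) S ×
             ∀ (k' : Fin (length R)) → Equivalent (L.lookup R k') S → k' ≡ k))

-- Every comparator network fixes the sorted vectors, so every output set
-- contains the n + 1 sorted vectors, and the output set of a sorting network
-- is exactly this set. A minimal output set therefore cannot contain an
-- unsorted vector, so it equals the sorted set. Conversely the sorted set is
-- minimal: Σ acts injectively, and an injection of the finite set of sorted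
-- vectors into itself is onto. Hence all minimal output sets coincide, and a
-- system of representatives has exactly one member.
module Submission where

open import Defs
open import Data.Nat using (ℕ; zero; suc; _≤_; z≤n; s≤s)
open import Data.Nat.Properties using (1+n≰n; <⇒≤)
open import Data.List using (List; length; []; _∷_)
import Data.List as List
open import Data.Product using (∃-syntax; _,_; proj₁; proj₂; _×_)
open import Data.Bool using (true; false; _∧_; _∨_)
import Data.Bool as Bool
open import Data.Bool.Properties
  using (not-injective; ≤-refl; ≤-minimum; ≤-maximum; ≤-antisym; _≟_)
open import Data.Fin using (Fin; punchOut) renaming (zero to fzero; suc to fsuc)
open import Data.Fin.Properties using (any?; injective⇒≤; punchOut-injective)
import Data.Fin.Properties as Fin
open import Data.Fin.Permutation using (_⟨$⟩ʳ_; _⟨$⟩ˡ_; inverseʳ)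
open import Data.Vec using (Vec; []; _∷_; head; lookup; _[_]≔_; replicate; map)
open import Data.Vec.Properties
  using (∷-injectiveʳ; ≡-dec; []≔-lookup; lookup-replicate; tabulate∘lookup;
         lookup∘tabulate; tabulate-cong; reverse-injective)
open import Function using (case_of_)
open import Function.Definitions using (Injective)
open import Relation.Binary.PropositionalEquality
  using (_≡_; _≢_; refl; sym; trans; cong; module ≡-Reasoning)
open import Relation.Nullary using (yes; no; contradiction)
open import Relation.Unary using (Decidable; _⊆_)

injective⇒surjective : ∀ {m} {f : Fin m → Fin m} → Injective _≡_ _≡_ f →
  ∀ k → ∃[ w ] f w ≡ k
injective⇒surjective {suc m} {f} f-inj k with any? (λ w → f w Fin.≟ k)
... | yes hit = hit
... | no miss = contradiction (injective⇒≤ {f = avoid} avoid-inj) 1+n≰n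
  where
  k≢f : ∀ w → k ≢ f w
  k≢f w k≡fw = miss (w , sym k≡fw)
  avoid : Fin (suc m) → Fin m
  avoid w = punchOut (k≢f w)
  avoid-inj : Injective _≡_ _≡_ avoid
  avoid-inj eq = f-inj (punchOut-injective (k≢f _) (k≢f _) eq)

Fin-center⇒≡1 : ∀ m (k : Fin m) → (∀ k' → k' ≡ k) → m ≡ 1
Fin-center⇒≡1 (suc zero)    k center = refl
Fin-center⇒≡1 (suc (suc m)) k center with trans (center fzero) (sym (center (fsuc fzero)))
... | ()

lookup-extensionality : ∀ {A : Set} {n} {xs ys : Vec A n} →
  (∀ a → lookup xs a ≡ lookup ys a) → xs ≡ ys
lookup-extensionality {xs = xs} {ys} eq =
  trans (sym (tabulate∘lookup xs)) (trans (tabulate-cong eq) (tabulate∘lookup ys))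

map-injective : ∀ {A B : Set} {n} {f : A → B} → Injective _≡_ _≡_ f →
  Injective _≡_ _≡_ (map {n = n} f)
map-injective f-inj {[]}     {[]}     eq = refl
map-injective f-inj {x ∷ xs} {y ∷ ys} eq
  with refl ← f-inj (cong head eq) =
  cong (x ∷_) (map-injective f-inj (∷-injectiveʳ eq))

sortedVec : ∀ n → Fin (suc n) → BVec n
sortedVec zero    _        = []
sortedVec (suc n) fzero    = replicate (suc n) true
sortedVec (suc n) (fsuc k) = false ∷ sortedVec n k

sortedVec-injective : ∀ {n} → Injective _≡_ _≡_ (sortedVec n)
sortedVec-injective {zero}  {fzero}  {fzero}  _  = refl
sortedVec-injective {suc n} {fzero}  {fzero}  _  = refl
sortedVec-injective {suc n} {fsuc k} {fsuc l} eq =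
  cong fsuc (sortedVec-injective (∷-injectiveʳ eq))

sortedVec-sorted : ∀ n (k : Fin (suc n)) → Sorted (sortedVec n k)
sortedVec-sorted (suc n) fzero    a        b        _
  rewrite lookup-replicate a true | lookup-replicate b true = ≤-refl
sortedVec-sorted (suc n) (fsuc k) fzero    b        _       = ≤-minimum _
sortedVec-sorted (suc n) (fsuc k) (fsuc a) (fsuc b) (s≤s p) = sortedVec-sorted n k a b p

all-true : ∀ {n} (xs : BVec n) → (∀ a → lookup xs a ≡ true) → xs ≡ replicate n true
all-true []       _    = refl
all-true (x ∷ xs) all with refl ← all fzero =
  cong (true ∷_) (all-true xs (λ a → all (fsuc a)))

sorted⇒sortedVec : ∀ {n} (x : BVec n) → Sorted x → ∃[ k ] x ≡ sortedVec n k
sorted⇒sortedVec []           _      = fzero , refl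
sorted⇒sortedVec (true ∷ xs)  sorted =
  fzero , cong (true ∷_) (all-true xs λ a →
    ≤-antisym (≤-maximum _) (sorted fzero (fsuc a) z≤n))
sorted⇒sortedVec (false ∷ xs) sorted
  with k , eq ← sorted⇒sortedVec xs (λ a b p → sorted (fsuc a) (fsuc b) (s≤s p)) =
  fsuc k , cong (false ∷_) eq

sorted? : ∀ {n} → Decidable (Sorted {n})
sorted? {n} x with any? (λ k → ≡-dec _≟_ x (sortedVec n k))
... | yes (k , refl) = yes (sortedVec-sorted n k)
... | no  ¬sortedVec = no (λ sorted → ¬sortedVec (sorted⇒sortedVec x sorted))

sorted-injection⇒surjection : ∀ {n} {f : BVec n → BVec n} → Injective _≡_ _≡_ f →
  (∀ x → Sorted x → Sorted (f x)) → ∀ {y} → Sorted y → ∃[ x ] (Sorted x × f x ≡ y)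
sorted-injection⇒surjection {n} {f} f-inj f-sorted {y} y-sorted
  with k , refl ← sorted⇒sortedVec y y-sorted =
  let w , index-w≡k = injective⇒surjective index-inj k in
  sortedVec n w , sortedVec-sorted n w , trans (image w) (cong (sortedVec n) index-w≡k)
  where
  index : Fin (suc n) → Fin (suc n)
  index w = proj₁ (sorted⇒sortedVec (f (sortedVec n w)) (f-sorted _ (sortedVec-sorted n w)))
  image : ∀ w → f (sortedVec n w) ≡ sortedVec n (index w)
  image w = proj₂ (sorted⇒sortedVec (f (sortedVec n w)) (f-sorted _ (sortedVec-sorted n w)))
  index-inj : Injective _≡_ _≡_ index
  index-inj {v} {w} eq =
    sortedVec-injective (f-inj (trans (image v) (trans (cong (sortedVec n) eq) (sym (image w)))))

∧-≤ : ∀ {a b} → a Bool.≤ b → a ∧ b ≡ a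
∧-≤ Bool.f≤t          = refl
∧-≤ {false} Bool.b≤b  = refl
∧-≤ {true}  Bool.b≤b  = refl

∨-≤ : ∀ {a b} → a Bool.≤ b → a ∨ b ≡ b
∨-≤ Bool.f≤t          = refl
∨-≤ {false} Bool.b≤b  = refl
∨-≤ {true}  Bool.b≤b  = refl

applyComp-sorted : ∀ {n} (c : Comparator n) {z : BVec n} → Sorted z → applyComp c z ≡ z
applyComp-sorted c {z} sorted = begin
  (z [ i c ]≔ (zi ∧ zj)) [ j c ]≔ (zi ∨ zj)
    ≡⟨ cong (λ b → (z [ i c ]≔ b) [ j c ]≔ (zi ∨ zj)) (∧-≤ zi≤zj) ⟩
  (z [ i c ]≔ zi) [ j c ]≔ (zi ∨ zj)
    ≡⟨ cong (λ b → (z [ i c ]≔ zi) [ j c ]≔ b) (∨-≤ zi≤zj) ⟩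
  (z [ i c ]≔ zi) [ j c ]≔ zj
    ≡⟨ cong (_[ j c ]≔ zj) ([]≔-lookup z (i c)) ⟩
  z [ j c ]≔ zj
    ≡⟨ []≔-lookup z (j c) ⟩
  z ∎
  where
  open ≡-Reasoning
  zi = lookup z (i c)
  zj = lookup z (j c)
  zi≤zj : zi Bool.≤ zj
  zi≤zj = sorted (i c) (j c) (<⇒≤ (i<j c))

applyComps-sorted : ∀ {n} (cs : List (Comparator n)) {z : BVec n} → Sorted z →
  List.foldl (λ w c → applyComp c w) z cs ≡ z
applyComps-sorted []       sorted = refl
applyComps-sorted (c ∷ cs) {z} sorted
  rewrite applyComp-sorted c {z} sorted = applyComps-sorted cs sorted

output-sorted : ∀ {n d} (C : Network n d) {z : BVec n} → Sorted z → output C z ≡ z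
output-sorted []             sorted = refl
output-sorted ((cs , _) ∷ C) {z} sorted
  rewrite applyComps-sorted cs {z} sorted = output-sorted C sorted

sorted⊆outSet : ∀ {n d} (C : Network n d) → Sorted ⊆ outSet C
sorted⊆outSet C {z} sorted = z , output-sorted C sorted

sortingNetwork⇒outSet⊆sorted : ∀ {n d} (C : Network n d) → IsSortingNetwork C →
  outSet C ⊆ Sorted
sortingNetwork⇒outSet⊆sorted C sorting (x , refl) = sorting x

InG⇒sorted⊆ : ∀ {n d} {S : VSet n} → InG n d S → Sorted ⊆ S
InG⇒sorted⊆ (C , _ , outSet⊆S) sorted = outSet⊆S (sorted⊆outSet C sorted)

SortingNetworkExists : ℕ → ℕ → Set
SortingNetworkExists n d = ∃[ C ] IsSortingNetwork {n} {d} C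

sortingNetwork⇒InG-sorted : ∀ {n d} → SortingNetworkExists n d → InG n d Sorted
sortingNetwork⇒InG-sorted (C , sorting) =
  C , sorted⊆outSet C , sortingNetwork⇒outSet⊆sorted C sorting

applyGen-injective : ∀ {n} (g : Gen n) → Injective _≡_ _≡_ (applyGen g)
applyGen-injective (perm π) {x} {y} eq = lookup-extensionality λ a → begin
  lookup x a                               ≡⟨ cong (lookup x) (inverseʳ π) ⟨
  lookup x (π ⟨$⟩ʳ (π ⟨$⟩ˡ a))              ≡⟨ lookup∘tabulate _ (π ⟨$⟩ˡ a) ⟨
  lookup (applyGen (perm π) x) (π ⟨$⟩ˡ a)   ≡⟨ cong (λ v → lookup v (π ⟨$⟩ˡ a)) eq ⟩
  lookup (applyGen (perm π) y) (π ⟨$⟩ˡ a)   ≡⟨ lookup∘tabulate _ (π ⟨$⟩ˡ a) ⟩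
  lookup y (π ⟨$⟩ʳ (π ⟨$⟩ˡ a))              ≡⟨ cong (lookup y) (inverseʳ π) ⟩
  lookup y a                               ∎
  where open ≡-Reasoning
applyGen-injective reflect eq = reverse-injective (map-injective not-injective eq)

applySym-injective : ∀ {n} (σ : SymW n) → Injective _≡_ _≡_ (applySym σ)
applySym-injective []      eq = eq
applySym-injective (g ∷ σ) eq = applySym-injective σ (applyGen-injective g eq)

sorted-minimal : ∀ {n d} → SortingNetworkExists n d → Minimal n d Sorted
sorted-minimal sorter =
  sortingNetwork⇒InG-sorted sorter ,
  λ { (S' , S'∈G , σ , σS'⊆sorted , sorted⊈σS') →
        sorted⊈σS' λ {y} y-sorted →
          let x , x-sorted , σx≡y =
                sorted-injection⇒surjection (applySym-injective σ)
                  (λ x x-sorted → σS'⊆sorted (x , InG⇒sorted⊆ S'∈G {x} x-sorted , refl))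
                  {y} y-sorted
          in x , InG⇒sorted⊆ S'∈G {x} x-sorted , σx≡y }

minimal⇒⊆sorted : ∀ {n d} {S : VSet n} → SortingNetworkExists n d →
  Minimal n d S → S ⊆ Sorted
minimal⇒⊆sorted sorter (S∈G , nothing-below) {x} x∈S with sorted? x
... | yes sorted = sorted
... | no  unsorted = contradiction
  (Sorted , sortingNetwork⇒InG-sorted sorter , [] ,
    (λ { (y , y-sorted , refl) → InG⇒sorted⊆ S∈G {y} y-sorted }) ,
    (λ S⊆sorted → case S⊆sorted x∈S of λ { (_ , y-sorted , refl) → unsorted y-sorted }))
  nothing-below

minimal≐sorted : ∀ {n d} {S : VSet n} → SortingNetworkExists n d →
  Minimal n d S → S ≐ Sorted
minimal≐sorted sorter S-minimal@(S∈G , _) =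
  minimal⇒⊆sorted sorter S-minimal , InG⇒sorted⊆ S∈G

≐⇒Equivalent : ∀ {n} {S T : VSet n} → S ≐ T → Equivalent S T
≐⇒Equivalent (S⊆T , T⊆S) =
  [] , (λ { (x , x∈T , refl) → T⊆S x∈T }) , (λ {x} x∈S → x , S⊆T x∈S , refl)

lemma5p2 : (n d : ℕ) → 1 ≤ n → (∃[ C ] IsSortingNetwork {n} {d} C) →
    (R : List (VSet n)) → IsRepresentatives n d R → length R ≡ 1
lemma5p2 n d _ sorter R (all-minimal , represented)
  with k , _ , unique ← represented Sorted (sorted-minimal sorter) =
  Fin-center⇒≡1 (length R) k λ k' →
    unique k' (≐⇒Equivalent (minimal≐sorted sorter (all-minimal k')))
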